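{- For all lists of integers $c_1,c_2$ with $\mathit{Wf}\ c_1$ and $\mathit{Wf}\ c_2$, and for all integers $\ell_1,\ell_2$: if $\ell_1\in c_1$, $\ell_2\in c_2$, $\mathit{NoCompLit}\ \ell_1\ c_2$, $\mathit{NoCompLit}\ \ell_2\ c_1$ and $\ell_1\neq\ell_2$, then $\ell_1\in c_1\bowtie c_2$ and $\ell_2\in c_1\bowtie c_2$.
   Context: Literals are integers and clauses are finite lists of integers. Lists are written $x::xs$ (cons) and $\mathit{nil}$ (empty); $\mathit{rev}$ reverses a list, $\mathit{app}$ concatenates two lists, $\mathit{abs}$ is the absolute value, and $\in$ denotes list membership. The function $\mathit{auxunion}(c_1,c_2,acc)$ is defined recursively by: - if $c_1=\mathit{nil}$, return $\mathit{app}(\mathit{rev}\ acc,c_2)$; - else if $c_2=\mathit{nil}$, return $\mathit{app}(\mathit{rev}\ acc,c_1)$; - else, with $c_1=x::xs$ and $c_2=y::ys$: - if $\mathit{abs}\,x<\mathit{abs}\,y$, return $\mathit{auxunion}(xs,y::ys,x::acc)$; - else if $\mathit{abs}\,y<\mathit{abs}\,x$, return $\mathit{auxunion}(x::xs,ys,y::acc)$; - else if $x=y$, return $\mathit{auxunion}(xs,ys,x::acc)$; - else return $\mathit{auxunion}(xs,ys,x::y::acc)$. The function $\mathit{union}(c_1,c_2,acc)$ is defined recursively by: - if $c_1=\mathit{nil}$, return $\mathit{app}(\mathit{rev}\ acc,c_2)$; - else if $c_2=\mathit{nil}$, return $\mathit{app}(\mathit{rev}\ acc,c_1)$; - else, with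 $c_1=x::xs$ and $c_2=y::ys$: - if $x+y=0$, return $\mathit{auxunion}(xs,ys,acc)$; - else if $\mathit{abs}\,x<\mathit{abs}\,y$, return $\mathit{union}(xs,y::ys,x::acc)$; - else if $\mathit{abs}\,y<\mathit{abs}\,x$, return $\mathit{union}(x::xs,ys,y::acc)$; - else return $\mathit{union}(xs,ys,x::acc)$. The resolution function is $c_1\bowtie c_2:=\mathit{union}(c_1,c_2,\mathit{nil})$. $\mathit{Wf}\ c$ means the conjunction of three conditions: - $\mathit{NoCompPair}\ c$: there is no literal $x\in c$ with $-x\in c$; - $\mathit{NoDup}\ c$: $c$ has no duplicate elements; - $\mathit{sorted}\ c$: $c$ is sorted in ascending order of absolute value. $\mathit{NoCompLit}\ \ell\ c$ means that there is no literal $m\in c$ with $\ell+m=0$. -}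

module Defs where

open import Data.Integer using (ℤ; _+_; ∣_∣; 0ℤ; -_)
open import Data.Integer.Properties using (_≟_)
open import Data.Nat using (_<_; _≤_; _<?_)
open import Data.List using (List; []; _∷_; reverse; _++_)
open import Data.List.Membership.Propositional using (_∈_)
open import Data.List.Relation.Unary.Unique.Propositional using (Unique)
open import Data.List.Relation.Unary.Linked using (Linked)
open import Data.Product using (_×_; ∃)
open import Relation.Nullary using (¬_)
open import Relation.Nullary.Decidable using (⌊_⌋)
open import Data.Bool using (if_then_else_)
open import Relation.Binary.PropositionalEquality using (_≡_)

Clause : Set
Clause = List ℤ

auxunion : Clause → Clause → Clause → Clause
auxunion [] c₂ acc = reverse acc ++ c₂
auxunion (x ∷ xs) [] acc = reverse acc ++ (x ∷ xs)
auxunion (x ∷ xs) (y ∷ ys) acc =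
  if ⌊ ∣ x ∣ <? ∣ y ∣ ⌋ then auxunion xs (y ∷ ys) (x ∷ acc)
  else if ⌊ ∣ y ∣ <? ∣ x ∣ ⌋ then auxunion (x ∷ xs) ys (y ∷ acc)
  else if ⌊ x ≟ y ⌋ then auxunion xs ys (x ∷ acc)
  else auxunion xs ys (x ∷ y ∷ acc)

union : Clause → Clause → Clause → Clause
union [] c₂ acc = reverse acc ++ c₂
union (x ∷ xs) [] acc = reverse acc ++ (x ∷ xs)
union (x ∷ xs) (y ∷ ys) acc =
  if ⌊ x + y ≟ 0ℤ ⌋ then auxunion xs ys acc
  else if ⌊ ∣ x ∣ <? ∣ y ∣ ⌋ then union xs (y ∷ ys) (x ∷ acc)
  else if ⌊ ∣ y ∣ <? ∣ x ∣ ⌋ then union (x ∷ xs) ys (y ∷ acc)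
  else union xs ys (x ∷ acc)

_⋈_ : Clause → Clause → Clause
c₁ ⋈ c₂ = union c₁ c₂ []

NoCompPair : Clause → Set
NoCompPair c = ¬ (∃ λ x → x ∈ c × (- x) ∈ c)

NoDup : Clause → Set
NoDup c = Unique c

sorted : Clause → Set
sorted c = Linked (λ x y → ∣ x ∣ ≤ ∣ y ∣) c

Wf : Clause → Set
Wf c = NoCompPair c × NoDup c × sorted c

NoCompLit : ℤ → Clause → Set
NoCompLit ℓ c = ¬ (∃ λ m → m ∈ c × ℓ + m ≡ 0ℤ)

-- The merge performed by union discards a literal only as one half of a
-- complementary pair x, y (x + y = 0) met at the heads of the two clauses;
-- every other literal of either clause is moved to the accumulator, and
-- auxunion, which finishes the merge once that pair is gone, discards nothing.
-- So a literal z of c₁ or c₂ survives in c₁ ⋈ c₂ as soon as − z occurs in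
-- neither clause: for ℓ₁ this is NoCompPair c₁ together with NoCompLit ℓ₁ c₂,
-- and symmetrically for ℓ₂.
module Submission where

open import Defs
open import Data.Integer using (ℤ; +_; -[1+_]; _+_; -_; ∣_∣; 0ℤ)
open import Data.Integer.Properties using (_≟_; n⊖n≡0; +-inverseʳ; +-0-abelianGroup)
open import Algebra.Properties.AbelianGroup +-0-abelianGroup using (inverseˡ-unique; inverseʳ-unique)
open import Data.Nat using (suc; _<_; _<?_)
open import Data.Nat.Properties using (≤-antisym; ≮⇒≥)
open import Data.List using (_∷_; []; reverse; _++_)
open import Data.List.Membership.Propositional using (_∈_; _∉_)
open import Data.List.Membership.Propositional.Properties using (∈-++⁺ˡ; ∈-++⁺ʳ)
open import Data.List.Relation.Unary.Any using (here; there)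
open import Data.List.Relation.Unary.Any.Properties using (reverse⁺)
open import Data.Product using (_×_; _,_)
open import Data.Sum using (_⊎_; inj₁; inj₂)
open import Relation.Nullary using (Dec; yes; no; ¬_)
open import Relation.Nullary.Decidable using (⌊_⌋)
open import Data.Bool using (if_then_else_)
open import Function using (_∘_)
open import Relation.Binary.PropositionalEquality using (_≡_; _≢_; refl; sym; cong)

∣i∣≡∣j∣∧i+j≢0⇒i≡j : ∀ i j → ∣ i ∣ ≡ ∣ j ∣ → i + j ≢ 0ℤ → i ≡ j
∣i∣≡∣j∣∧i+j≢0⇒i≡j (+ m)     (+ n)     eq      _    = cong +_ eq
∣i∣≡∣j∣∧i+j≢0⇒i≡j -[1+ m ]  -[1+ n ]  refl    _    = refl
∣i∣≡∣j∣∧i+j≢0⇒i≡j (+ _)     -[1+ n ]  refl    i+j≢0 with () ← i+j≢0 (n⊖n≡0 (suc n))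
∣i∣≡∣j∣∧i+j≢0⇒i≡j -[1+ m ]  (+ _)     refl    i+j≢0 with () ← i+j≢0 (n⊖n≡0 (suc m))

NoCompPair⇒-∉ : ∀ {c z} → NoCompPair c → z ∈ c → (- z) ∉ c
NoCompPair⇒-∉ {z = z} ncp z∈c -z∈c = ncp (z , z∈c , -z∈c)

NoCompLit⇒-∉ : ∀ {c z} → NoCompLit z c → (- z) ∉ c
NoCompLit⇒-∉ {z = z} ncl -z∈c = ncl (- z , -z∈c , +-inverseʳ z)

-- Invariant of the merge: z is already emitted (in acc) or still pending in an input.
Occurs : ℤ → Clause → Clause → Clause → Set
Occurs z acc c₁ c₂ = z ∈ acc ⊎ z ∈ c₁ ⊎ z ∈ c₂

module _ {z : ℤ} where

  ∈-reverse-++ : ∀ {acc c} → z ∈ acc ⊎ z ∈ c → z ∈ reverse acc ++ c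
  ∈-reverse-++ {acc} (inj₁ z∈acc) = ∈-++⁺ˡ (reverse⁺ {xs = acc} z∈acc)
  ∈-reverse-++ {acc} (inj₂ z∈c)   = ∈-++⁺ʳ (reverse acc) z∈c

  Occurs-[]ˡ : ∀ {acc c} → Occurs z acc [] c → z ∈ acc ⊎ z ∈ c
  Occurs-[]ˡ (inj₁ z∈acc)       = inj₁ z∈acc
  Occurs-[]ˡ (inj₂ (inj₂ z∈c))  = inj₂ z∈c

  Occurs-[]ʳ : ∀ {acc c} → Occurs z acc c [] → z ∈ acc ⊎ z ∈ c
  Occurs-[]ʳ (inj₁ z∈acc)       = inj₁ z∈acc
  Occurs-[]ʳ (inj₂ (inj₁ z∈c))  = inj₂ z∈c

  ∈-if : ∀ {P : Set} {c c′} (d : Dec P) → (P → z ∈ c) → (¬ P → z ∈ c′) →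
         z ∈ (if ⌊ d ⌋ then c else c′)
  ∈-if (yes p)  z∈c  _     = z∈c p
  ∈-if (no ¬p)  _    z∈c′  = z∈c′ ¬p

  emitˡ : ∀ {x xs ys acc} → Occurs z acc (x ∷ xs) ys → Occurs z (x ∷ acc) xs ys
  emitˡ (inj₁ z∈acc)                = inj₁ (there z∈acc)
  emitˡ (inj₂ (inj₁ (here z≡x)))    = inj₁ (here z≡x)
  emitˡ (inj₂ (inj₁ (there z∈xs)))  = inj₂ (inj₁ z∈xs)
  emitˡ (inj₂ (inj₂ z∈ys))          = inj₂ (inj₂ z∈ys)

  emitʳ : ∀ {y xs ys acc} → Occurs z acc xs (y ∷ ys) → Occurs z (y ∷ acc) xs ys
  emitʳ (inj₁ z∈acc)                = inj₁ (there z∈acc)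
  emitʳ (inj₂ (inj₁ z∈xs))          = inj₂ (inj₁ z∈xs)
  emitʳ (inj₂ (inj₂ (here z≡y)))    = inj₁ (here z≡y)
  emitʳ (inj₂ (inj₂ (there z∈ys)))  = inj₂ (inj₂ z∈ys)

  dropʳ-emitted : ∀ {y xs ys acc} → y ∈ acc → Occurs z acc xs (y ∷ ys) → Occurs z acc xs ys
  dropʳ-emitted _     (inj₁ z∈acc)                = inj₁ z∈acc
  dropʳ-emitted _     (inj₂ (inj₁ z∈xs))          = inj₂ (inj₁ z∈xs)
  dropʳ-emitted y∈acc (inj₂ (inj₂ (here refl)))   = inj₁ y∈acc
  dropʳ-emitted _     (inj₂ (inj₂ (there z∈ys)))  = inj₂ (inj₂ z∈ys)

  drop-heads : ∀ {x y xs ys acc} → z ≢ x → z ≢ y →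
               Occurs z acc (x ∷ xs) (y ∷ ys) → Occurs z acc xs ys
  drop-heads _   _   (inj₁ z∈acc)                = inj₁ z∈acc
  drop-heads z≢x _   (inj₂ (inj₁ (here z≡x)))    with () ← z≢x z≡x
  drop-heads _   _   (inj₂ (inj₁ (there z∈xs)))  = inj₂ (inj₁ z∈xs)
  drop-heads _   z≢y (inj₂ (inj₂ (here z≡y)))    with () ← z≢y z≡y
  drop-heads _   _   (inj₂ (inj₂ (there z∈ys)))  = inj₂ (inj₂ z∈ys)

  ∈-auxunion : ∀ c₁ c₂ acc → Occurs z acc c₁ c₂ → z ∈ auxunion c₁ c₂ acc
  ∈-auxunion []       c₂       acc occ = ∈-reverse-++ {acc} {c₂} (Occurs-[]ˡ occ)
  ∈-auxunion (x ∷ xs) []       acc occ = ∈-reverse-++ {acc} {x ∷ xs} (Occurs-[]ʳ occ)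
  ∈-auxunion (x ∷ xs) (y ∷ ys) acc occ =
    ∈-if (∣ x ∣ <? ∣ y ∣) (λ _ → ∈-auxunion xs (y ∷ ys) (x ∷ acc) (emitˡ occ)) λ _ →
    ∈-if (∣ y ∣ <? ∣ x ∣) (λ _ → ∈-auxunion (x ∷ xs) ys (y ∷ acc) (emitʳ occ)) λ _ →
    ∈-if (x ≟ y) (λ x≡y → ∈-auxunion xs ys (x ∷ acc) (dropʳ-emitted (here (sym x≡y)) (emitˡ occ)))
                 (λ _ → ∈-auxunion xs ys (x ∷ y ∷ acc) (emitˡ (emitʳ occ)))

  ∈-union : ∀ c₁ c₂ acc → (- z) ∉ c₁ → (- z) ∉ c₂ → Occurs z acc c₁ c₂ → z ∈ union c₁ c₂ acc
  ∈-union []       c₂       acc _      _      occ = ∈-reverse-++ {acc} {c₂} (Occurs-[]ˡ occ)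
  ∈-union (x ∷ xs) []       acc _      _      occ = ∈-reverse-++ {acc} {x ∷ xs} (Occurs-[]ʳ occ)
  ∈-union (x ∷ xs) (y ∷ ys) acc -z∉c₁ -z∉c₂ occ =
    ∈-if (x + y ≟ 0ℤ)
      (λ x+y≡0 → ∈-auxunion xs ys acc (drop-heads (z≢x x+y≡0) (z≢y x+y≡0) occ)) λ x+y≢0 →
    ∈-if (∣ x ∣ <? ∣ y ∣)
      (λ _ → ∈-union xs (y ∷ ys) (x ∷ acc) (-z∉c₁ ∘ there) -z∉c₂ (emitˡ occ)) λ ∣x∣≮∣y∣ →
    ∈-if (∣ y ∣ <? ∣ x ∣)
      (λ _ → ∈-union (x ∷ xs) ys (y ∷ acc) -z∉c₁ (-z∉c₂ ∘ there) (emitʳ occ)) λ ∣y∣≮∣x∣ →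
    ∈-union xs ys (x ∷ acc) (-z∉c₁ ∘ there) (-z∉c₂ ∘ there)
      (dropʳ-emitted (here (y≡x ∣x∣≮∣y∣ ∣y∣≮∣x∣ x+y≢0)) (emitˡ occ))
    where
    z≢x : x + y ≡ 0ℤ → z ≢ x
    z≢x x+y≡0 refl = -z∉c₂ (here (sym (inverseʳ-unique x y x+y≡0)))
    z≢y : x + y ≡ 0ℤ → z ≢ y
    z≢y x+y≡0 refl = -z∉c₁ (here (sym (inverseˡ-unique x y x+y≡0)))
    y≡x : ¬ ∣ x ∣ < ∣ y ∣ → ¬ ∣ y ∣ < ∣ x ∣ → x + y ≢ 0ℤ → y ≡ x
    y≡x ∣x∣≮∣y∣ ∣y∣≮∣x∣ x+y≢0 =
      sym (∣i∣≡∣j∣∧i+j≢0⇒i≡j x y (≤-antisym (≮⇒≥ ∣y∣≮∣x∣) (≮⇒≥ ∣x∣≮∣y∣)) x+y≢0)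

∈-⋈ : ∀ {z c₁ c₂} → z ∈ c₁ ⊎ z ∈ c₂ → (- z) ∉ c₁ → (- z) ∉ c₂ → z ∈ c₁ ⋈ c₂
∈-⋈ {c₁ = c₁} {c₂} z∈c₁∪c₂ -z∉c₁ -z∉c₂ = ∈-union c₁ c₂ [] -z∉c₁ -z∉c₂ (inj₂ z∈c₁∪c₂)

theorem3 : (c₁ c₂ : Clause) → Wf c₁ → Wf c₂ → (ℓ₁ ℓ₂ : ℤ) →
    ℓ₁ ∈ c₁ → ℓ₂ ∈ c₂ → NoCompLit ℓ₁ c₂ → NoCompLit ℓ₂ c₁ → ℓ₁ ≢ ℓ₂ →
    ℓ₁ ∈ (c₁ ⋈ c₂) × ℓ₂ ∈ (c₁ ⋈ c₂)
theorem3 c₁ c₂ (ncp₁ , _) (ncp₂ , _) ℓ₁ ℓ₂ ℓ₁∈c₁ ℓ₂∈c₂ ncl₁ ncl₂ _ =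
  ∈-⋈ (inj₁ ℓ₁∈c₁) (NoCompPair⇒-∉ ncp₁ ℓ₁∈c₁) (NoCompLit⇒-∉ ncl₁) ,
  ∈-⋈ (inj₂ ℓ₂∈c₂) (NoCompLit⇒-∉ ncl₂) (NoCompPair⇒-∉ ncp₂ ℓ₂∈c₂)
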